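{- The value $\operatorname{bdim}(G)-\operatorname{bdim}(G-e)$ can be arbitrarily large: for every $M$ there exist a connected graph $G$ and an edge $e\in E(G)$ such that $G-e$ is connected and $\operatorname{bdim}(G)-\operatorname{bdim}(G-e)\ge M$.
   Context: All graphs are finite, simple and undirected. $d(u,v)$ denotes graph distance, and for a positive integer $k$, $d_k(u,v)=\min\{d(u,v),k+1\}$. A function $f:V(G)\to\mathbb{Z}_{\ge0}$ is a resolving broadcast of $G$ if for any distinct $x,y\in V(G)$ there is $z$ with $f(z)>0$ and $d_{f(z)}(x,z)\ne d_{f(z)}(y,z)$; $\operatorname{bdim}(G)$ is the minimum of $\sum_v f(v)$ over resolving broadcasts $f$ of $G$. $G-e$ denotes $G$ with the edge $e$ removed. -}

module Defs where

open import Data.Nat using (ℕ; zero; suc; _+_; _≤_; _⊓_)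
open import Data.Fin using (Fin)
open import Data.List using (List; map; allFin)
open import Data.Nat.ListAction using (sum)
open import Data.Product using (Σ; ∃; ∃-syntax; _×_; _,_)
open import Data.Sum using (_⊎_)
open import Relation.Nullary using (¬_)
open import Relation.Binary.PropositionalEquality using (_≡_; _≢_)
open import Level using (0ℓ; suc)

record Graph (n : ℕ) : Set₁ where
  field
    Adj   : Fin n → Fin n → Set
    sym   : ∀ {u v} → Adj u v → Adj v u
    irrefl : ∀ {u} → ¬ Adj u u
open Graph public

data Walk {n : ℕ} (G : Graph n) : Fin n → Fin n → ℕ → Set where
  nil  : ∀ {u} → Walk G u u 0
  cons : ∀ {u w v k} → Adj G u w → Walk G w v k → Walk G u v (ℕ.suc k)

Connected : ∀ {n} → Graph n → Set
Connected {n} G = ∀ (u v : Fin n) → ∃[ k ] Walk G u v k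

Dist : ∀ {n} → Graph n → Fin n → Fin n → ℕ → Set
Dist G u v k = Walk G u v k × (∀ j → Walk G u v j → k ≤ j)

TDist : ∀ {n} → Graph n → ℕ → Fin n → Fin n → ℕ → Set
TDist G r u v t = ∃[ k ] (Dist G u v k × t ≡ k ⊓ ℕ.suc r)

Resolving : ∀ {n} → Graph n → (Fin n → ℕ) → Set
Resolving {n} G f =
  ∀ (x y : Fin n) → x ≢ y →
    ∃[ z ] (0 Data.Nat.< f z × ∃[ a ] ∃[ b ]
      (TDist G (f z) x z a × TDist G (f z) y z b × a ≢ b))

cost : ∀ {n} → (Fin n → ℕ) → ℕ
cost {n} f = sum (map f (allFin n))

IsBdim : ∀ {n} → Graph n → ℕ → Set
IsBdim G b = (∃[ f ] (Resolving G f × cost f ≡ b))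
           × (∀ f → Resolving G f → b ≤ cost f)

removeEdge : ∀ {n} → (G : Graph n) → (a b : Fin n) → Graph n
removeEdge G a b = record
  { Adj = λ u v → Adj G u v × ¬ ((u ≡ a × v ≡ b) ⊎ (u ≡ b × v ≡ a))
  ; sym = λ { (h , ne) → sym G h , λ { (Data.Sum.inj₁ (p , q)) → ne (Data.Sum.inj₂ (q , p))
                                    ; (Data.Sum.inj₂ (p , q)) → ne (Data.Sum.inj₁ (q , p)) } }
  ; irrefl = λ { (h , _) → irrefl G h }
  }

module Submission where

-- For N ≥ 1 we build a graph G_N on 3 + 7N vertices: three hub vertices
-- C, B, A with the edge e = CB, and N gadgets, each on the seven vertices
-- X, Y, P, X′, Y′, P′, W (W adjacent to the other six, plus X–P, X′–P′).
-- Hubs attach as C ~ P, P′;  B ~ X, Y, X′, Y′;  A ~ X′, Y′, P′.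
--
-- In G_N both (X, Y, P) and (X′, Y′, P′) are near twins x, y
-- with helper p: N(y) ⊆ N(x) ⊆ N(y) ∪ {p}, and every neighbour of p is x or
-- within distance 2 of y (for the neighbour C this uses the path C–B–Y).
-- Near twins are equidistant from every vertex outside {x, y, p}, so a
-- resolving broadcast is positive on each such triple; 2N disjoint triples
-- give bdim(G_N) ≥ 2N.  In G_N − e the broadcast C ↦ 2, A ↦ 1, W_i ↦ 1 resolves:
-- the truncated distances to C, A and the W_i determine every vertex.  Hence
-- bdim(G_N − e) ≤ N + 3, and N = M + 3 gives a difference of at least M.

open import Defs
open import Data.Bool using (Bool; true; false; T; _∧_; _∨_)
open import Data.Bool.Properties using (∨-comm; ∧-zeroʳ; ∧-identityʳ)
open import Data.Empty using (⊥; ⊥-elim)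
open import Data.Fin using (Fin; zero; suc; toℕ; fromℕ<)
open import Data.Fin.Properties using (any?; all?; toℕ-fromℕ<; toℕ<n) renaming (_≟_ to _≟ᶠ_)
open import Data.List using (map; allFin)
open import Data.List.Properties using (map-tabulate; map-cong)
open import Data.Nat using (ℕ; zero; suc; _+_; _∸_; _≤_; _<_; _⊓_; z≤n; s≤s)
open import Data.Nat.ListAction using (sum)
import Data.Nat.Properties as ℕ
open import Data.Product using (Σ; ∃; ∃-syntax; _×_; _,_; proj₁; proj₂)
open import Data.Sum using (_⊎_; inj₁; inj₂)
open import Data.Unit using (tt)
open import Function using (_∘_; id)
open import Relation.Nullary using (¬_; Dec; yes; no)
open import Relation.Nullary.Decidable using (T?; ¬?; _×-dec_; _⊎-dec_)
import Relation.Binary.PropositionalEquality as ≡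
open ≡ using (_≡_; _≢_; refl; trans; cong; cong₂; subst; subst₂)

snoc : ∀ {n} {G : Graph n} {u v w k} → Walk G u v k → Adj G v w → Walk G u w (suc k)
snoc nil e = cons e nil
snoc (cons e p) e′ = cons e (snoc p e′)

reverse : ∀ {n} {G : Graph n} {u v k} → Walk G u v k → Walk G v u k
reverse nil = nil
reverse {G = G} (cons e p) = snoc (reverse p) (sym G e)

_++ʷ_ : ∀ {n} {G : Graph n} {u v w k l} → Walk G u v k → Walk G v w l → Walk G u w (k + l)
nil ++ʷ q = q
cons e p ++ʷ q = cons e (p ++ʷ q)

mapWalk : ∀ {n} {G H : Graph n} → (∀ {u v} → Adj G u v → Adj H u v) →
          ∀ {u v k} → Walk G u v k → Walk H u v k
mapWalk f nil = nil
mapWalk f (cons e p) = cons (f e) (mapWalk f p)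

DecAdj : ∀ {n} → Graph n → Set
DecAdj {n} G = ∀ (u v : Fin n) → Dec (Adj G u v)

walk? : ∀ {n} (G : Graph n) → DecAdj G → ∀ k u v → Dec (Walk G u v k)
walk? G adj? zero u v with u ≟ᶠ v
... | yes refl = yes nil
... | no u≢v = no λ { nil → u≢v refl }
walk? G adj? (suc k) u v with any? firstStep?
  where
  firstStep? : ∀ w → Dec (Adj G u w × Walk G w v k)
  firstStep? w = adj? u w ×-dec walk? G adj? k w v
... | yes (w , e , p) = yes (cons e p)
... | no none = no λ { (cons e p) → none (_ , e , p) }

least : (P : ℕ → Set) → (∀ k → Dec (P k)) → ∀ K → P K →
        ∃[ j ] (P j × (∀ i → P i → j ≤ i))
least P P? K pK with P? 0
... | yes p0 = 0 , p0 , λ _ _ → z≤n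
least P P? zero pK | no ¬p0 = ⊥-elim (¬p0 pK)
least P P? (suc K) pK | no ¬p0 with least (P ∘ suc) (P? ∘ suc) K pK
... | j , pj , min = suc j , pj , λ { zero p → ⊥-elim (¬p0 p) ; (suc i) p → s≤s (min i p) }

dist-unique : ∀ {n} {G : Graph n} {u v k l} → Dist G u v k → Dist G u v l → k ≡ l
dist-unique (p , min-p) (q , min-q) = ℕ.≤-antisym (min-p _ q) (min-q _ p)

module LocalDistance {n} (G : Graph n) where

  dist-self : ∀ {u k} → Dist G u u k → k ≡ 0
  dist-self (_ , min) = ℕ.n≤0⇒n≡0 (min 0 nil)

  dist-adj : ∀ {u z k} → u ≢ z → Adj G u z → Dist G u z k → k ≡ 1
  dist-adj u≢z e (nil , _) = ⊥-elim (u≢z refl)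
  dist-adj u≢z e (cons _ nil , _) = refl
  dist-adj u≢z e (cons _ (cons _ _) , min) with min 1 (cons e nil)
  ... | s≤s ()

  dist-two : ∀ {u z w k} → u ≢ z → ¬ Adj G u z → Adj G u w → Adj G w z → Dist G u z k → k ≡ 2
  dist-two u≢z ¬e e₁ e₂ (nil , _) = ⊥-elim (u≢z refl)
  dist-two u≢z ¬e e₁ e₂ (cons e nil , _) = ⊥-elim (¬e e)
  dist-two u≢z ¬e e₁ e₂ (cons _ (cons _ nil) , _) = refl
  dist-two u≢z ¬e e₁ e₂ (cons _ (cons _ (cons _ _)) , min) with min 2 (cons e₁ (cons e₂ nil))
  ... | s≤s (s≤s ())

  dist-≥2 : ∀ {u z k} → u ≢ z → ¬ Adj G u z → Dist G u z k → 2 ≤ k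
  dist-≥2 u≢z ¬e (nil , _) = ⊥-elim (u≢z refl)
  dist-≥2 u≢z ¬e (cons e nil , _) = ⊥-elim (¬e e)
  dist-≥2 u≢z ¬e (cons _ (cons _ _) , _) = s≤s (s≤s z≤n)

  dist-≥3 : ∀ {u z k} → u ≢ z → ¬ Adj G u z → (∀ w → Adj G u w → Adj G w z → ⊥) →
            Dist G u z k → 3 ≤ k
  dist-≥3 u≢z ¬e ¬path (nil , _) = ⊥-elim (u≢z refl)
  dist-≥3 u≢z ¬e ¬path (cons e nil , _) = ⊥-elim (¬e e)
  dist-≥3 u≢z ¬e ¬path (cons e₁ (cons e₂ nil) , _) = ⊥-elim (¬path _ e₁ e₂)
  dist-≥3 u≢z ¬e ¬path (cons _ (cons _ (cons _ _)) , _) = s≤s (s≤s (s≤s z≤n))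

cost-suc : ∀ {m} (f : Fin (suc m) → ℕ) → cost f ≡ f zero + cost (f ∘ suc)
cost-suc {m} f = cong (λ xs → f zero + sum xs)
  (trans (map-tabulate suc f) (≡.sym (map-tabulate id (f ∘ suc))))

cost-cong : ∀ {m} {f g : Fin m → ℕ} → (∀ i → f i ≡ g i) → cost f ≡ cost g
cost-cong {m} f≗g = cong sum (map-cong f≗g (allFin m))

extend : ∀ {m} → ℕ → (Fin m → ℕ) → Fin (suc m) → ℕ
extend v g zero = v
extend v g (suc i) = g i

cost-search : ∀ m (Q : (Fin m → ℕ) → Set) → (∀ f → Dec (Q f)) →
  (∀ f g → (∀ i → f i ≡ g i) → Q f → Q g) → ∀ k → Dec (∃[ f ] (Q f × cost f ≡ k))
cost-search zero Q Q? Q-ext k with Q? (λ ()) | k ℕ.≟ 0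
... | yes q | yes refl = yes ((λ ()) , q , refl)
... | no ¬q | _ = no λ { (f , q , _) → ¬q (Q-ext f (λ ()) (λ ()) q) }
... | _ | no k≢0 = no λ { (_ , _ , c) → k≢0 (≡.sym c) }
cost-search (suc m) Q Q? Q-ext k with any? headValue?
  where
  -- the value at zero is some v ≤ k, and the tail then has cost k ∸ v
  headValue? : ∀ (v : Fin (suc k)) →
    Dec (∃[ g ] (Q (extend (toℕ v) g) × cost g ≡ k ∸ toℕ v))
  headValue? v = cost-search m (Q ∘ extend (toℕ v)) (Q? ∘ extend (toℕ v))
    (λ f g f≗g → Q-ext _ _ λ { zero → refl ; (suc i) → f≗g i }) (k ∸ toℕ v)
... | yes (v , g , q , c) = yes (extend (toℕ v) g , q ,
      trans (cost-suc (extend (toℕ v) g))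
            (trans (cong (toℕ v +_) c) (ℕ.m+[n∸m]≡n (ℕ.≤-pred (toℕ<n v)))))
... | no none = no λ { (f , q , c) → none (split f q c) }
  where
  split : ∀ f → Q f → cost f ≡ k → ∃[ v ] ∃[ g ] (Q (extend (toℕ v) g) × cost g ≡ k ∸ toℕ v)
  split f q c = fromℕ< (s≤s head≤k) , f ∘ suc ,
      Q-ext f _ (λ { zero → ≡.sym (toℕ-fromℕ< (s≤s head≤k)) ; (suc i) → refl }) q ,
      subst (λ t → cost (f ∘ suc) ≡ k ∸ t) (≡.sym (toℕ-fromℕ< (s≤s head≤k))) tail-cost
    where
    f-cost : f zero + cost (f ∘ suc) ≡ k
    f-cost = trans (≡.sym (cost-suc f)) c
    head≤k : f zero ≤ k
    head≤k = subst (f zero ≤_) f-cost (ℕ.m≤m+n (f zero) _)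
    tail-cost : cost (f ∘ suc) ≡ k ∸ f zero
    tail-cost = trans (≡.sym (ℕ.m+n∸m≡n (f zero) _)) (cong (_∸ f zero) f-cost)

resolving-ext : ∀ {n} (G : Graph n) f g → (∀ i → f i ≡ g i) → Resolving G f → Resolving G g
resolving-ext G f g f≗g R x y x≢y with R x y x≢y
... | z , p , a , b , ta , tb , a≢b rewrite f≗g z = z , p , a , b , ta , tb , a≢b

module Distances {n} (G : Graph n) (adj? : DecAdj G) (conn : Connected G) where

  distance : ∀ u v → ∃[ k ] Dist G u v k
  distance u v with conn u v
  ... | K , w = least (λ j → Walk G u v j) (λ j → walk? G adj? j u v) K w

  d : Fin n → Fin n → ℕ
  d u v = proj₁ (distance u v)

  d-spec : ∀ u v → Dist G u v (d u v)
  d-spec u v = proj₂ (distance u v)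

  tdist-value : ∀ {r x z a} → TDist G r x z a → a ≡ d x z ⊓ suc r
  tdist-value (k , dk , a≡) = trans a≡ (cong (_⊓ _) (dist-unique dk (d-spec _ _)))

  tdist-intro : ∀ {u z} r t → (∀ {k} → Dist G u z k → k ⊓ suc r ≡ t) → TDist G r u z t
  tdist-intro {u} {z} r t value = d u z , d-spec u z , ≡.sym (value (d-spec u z))

  resolving? : ∀ f → Dec (Resolving G f)
  resolving? f = all? λ x → all? λ y → pair? x y
    where
    separates? : ∀ x y z → Dec (0 < f z × ∃[ a ] ∃[ b ]
                   (TDist G (f z) x z a × TDist G (f z) y z b × a ≢ b))
    separates? x y z with 1 ℕ.≤? f z | (d x z ⊓ suc (f z)) ℕ.≟ (d y z ⊓ suc (f z))
    ... | no ¬p | _ = no λ { (p , _) → ¬p p }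
    ... | yes p | no differ = yes (p , _ , _ , (_ , d-spec x z , refl) , (_ , d-spec y z , refl) , differ)
    ... | yes p | yes same = no λ { (_ , _ , _ , ta , tb , a≢b) →
            a≢b (trans (tdist-value ta) (trans same (≡.sym (tdist-value tb)))) }
    pair? : ∀ x y → Dec (x ≢ y → ∃[ z ] (0 < f z × ∃[ a ] ∃[ b ]
              (TDist G (f z) x z a × TDist G (f z) y z b × a ≢ b)))
    pair? x y with x ≟ᶠ y
    ... | yes x≡y = yes λ x≢y → ⊥-elim (x≢y x≡y)
    ... | no x≢y with any? (separates? x y)
    ...   | yes s = yes λ _ → s
    ...   | no ¬s = no λ h → ¬s (h x≢y)

  -- The constant broadcast 1 resolves G: every vertex tells itself apart.
  all-ones-resolving : Resolving G (λ _ → 1)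
  all-ones-resolving x y x≢y =
    x , s≤s z≤n , 0 , d y x ⊓ 2 , (0 , (nil , λ _ _ → z≤n) , refl) , (_ , d-spec y x , refl) , 0≢
    where
    0≢ : 0 ≢ d y x ⊓ 2
    0≢ eq with d y x | d-spec y x
    ... | zero | (nil , _) = x≢y refl
    ... | suc k | _ with eq
    ... | ()

  bdim-exists : ∃[ β ] IsBdim G β
  bdim-exists with least (λ k → ∃[ f ] (Resolving G f × cost f ≡ k))
                         (cost-search n (Resolving G) resolving? (resolving-ext G))
                         _ ((λ _ → 1) , all-ones-resolving , refl)
  ... | β , attained , min = β , attained , λ f R → min _ (f , R , refl)

bdim-≥ : ∀ {n} {G : Graph n} {L β} → (∀ f → Resolving G f → L ≤ cost f) → IsBdim G β → L ≤ β
bdim-≥ lower ((f , R , refl) , _) = lower f R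

bdim-≤ : ∀ {n} {G : Graph n} {f β} → Resolving G f → IsBdim G β → β ≤ cost f
bdim-≤ R (_ , minimal) = minimal _ R

module NearTwins {n} (G : Graph n) (x y p : Fin n)
  (N[y]⊆N[x] : ∀ w → Adj G w y → Adj G w x)
  (N[x]⊆N[y]∪p : ∀ w → Adj G w x → Adj G w y ⊎ w ≡ p)
  (N[p]-near-y : ∀ u → Adj G u p → u ≡ x ⊎ Adj G u y ⊎ ∃[ w ] (Adj G u w × Adj G w y)) where

  from-y : ∀ {z k} → z ≢ x → z ≢ p → Walk G x z k → ∃[ j ] (j ≤ k × Walk G y z j)
  from-y z≢x z≢p nil = ⊥-elim (z≢x refl)
  from-y z≢x z≢p (cons {w = w} e rest) with N[x]⊆N[y]∪p w (sym G e)
  ... | inj₁ w~y = _ , ℕ.≤-refl , cons (sym G w~y) rest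
  from-y z≢x z≢p (cons e nil) | inj₂ refl = ⊥-elim (z≢p refl)
  from-y z≢x z≢p (cons e (cons {w = u} e′ rest)) | inj₂ refl with N[p]-near-y u (sym G e′)
  ... | inj₁ refl with from-y z≢x z≢p rest
  ...   | j , j≤ , q = j , ℕ.≤-trans j≤ (ℕ.≤-trans (ℕ.n≤1+n _) (ℕ.n≤1+n _)) , q
  from-y z≢x z≢p (cons e (cons e′ rest)) | inj₂ refl | inj₂ (inj₁ u~y) =
    _ , ℕ.n≤1+n _ , cons (sym G u~y) rest
  from-y z≢x z≢p (cons e (cons e′ rest)) | inj₂ refl | inj₂ (inj₂ (w′ , u~w′ , w′~y)) =
    _ , ℕ.≤-refl , cons (sym G w′~y) (cons (sym G u~w′) rest)

  from-x : ∀ {z k} → z ≢ y → Walk G y z k → Walk G x z k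
  from-x z≢y nil = ⊥-elim (z≢y refl)
  from-x z≢y (cons e rest) = cons (sym G (N[y]⊆N[x] _ (sym G e))) rest

  equidistant : ∀ {z k l} → z ≢ x → z ≢ y → z ≢ p → Dist G x z k → Dist G y z l → k ≡ l
  equidistant z≢x z≢y z≢p (wx , min-x) (wy , min-y) with from-y z≢x z≢p wx
  ... | j , j≤ , q = ℕ.≤-antisym (min-x _ (from-x z≢y wy)) (ℕ.≤-trans (min-y _ q) j≤)

  broadcast-hits : ∀ f → Resolving G f → x ≢ y → 0 < f x ⊎ 0 < f y ⊎ 0 < f p
  broadcast-hits f R x≢y with R x y x≢y
  ... | z , pos , a , b , (k , dk , a≡) , (l , dl , b≡) , a≢b
        with z ≟ᶠ x | z ≟ᶠ y | z ≟ᶠ p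
  ... | yes refl | _ | _ = inj₁ pos
  ... | no _ | yes refl | _ = inj₂ (inj₁ pos)
  ... | no _ | no _ | yes refl = inj₂ (inj₂ pos)
  ... | no z≢x | no z≢y | no z≢p =
        ⊥-elim (a≢b (trans a≡ (trans (cong (_⊓ _) (equidistant z≢x z≢y z≢p dk dl)) (≡.sym b≡))))

data Hub : Set where
  C B A : Hub

data Slot : Set where
  X Y P X′ Y′ P′ W : Slot

data V (N : ℕ) : Set where
  hub : Hub → V N
  gad : Fin N → Slot → V N

slotEdge : Slot → Slot → Bool
slotEdge X P = true
slotEdge X W = true
slotEdge Y W = true
slotEdge P W = true
slotEdge X′ P′ = true
slotEdge X′ W = true
slotEdge Y′ W = true
slotEdge P′ W = true
slotEdge _ _ = false

slotAdj : Slot → Slot → Bool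
slotAdj s t = slotEdge s t ∨ slotEdge t s

attached : Hub → Slot → Bool
attached C P = true
attached C P′ = true
attached B X = true
attached B Y = true
attached B X′ = true
attached B Y′ = true
attached A X′ = true
attached A Y′ = true
attached A P′ = true
attached _ _ = false

hubEdge : Hub → Hub → Bool
hubEdge C B = true
hubEdge _ _ = false

-- Adjacency of G_N (flag true) and of G_N − CB (flag false).
AdjV : ∀ {N} → Bool → V N → V N → Set
AdjV withCB (hub h) (hub h′) = T ((hubEdge h h′ ∨ hubEdge h′ h) ∧ withCB)
AdjV withCB (hub h) (gad _ t) = T (attached h t)
AdjV withCB (gad _ t) (hub h) = T (attached h t)
AdjV withCB (gad i s) (gad j t) = i ≡ j × T (slotAdj s t)

AdjV-sym : ∀ {N} e (a b : V N) → AdjV e a b → AdjV e b a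
AdjV-sym e (hub h) (hub h′) ab = subst (λ c → T (c ∧ e)) (∨-comm (hubEdge h h′) (hubEdge h′ h)) ab
AdjV-sym e (hub h) (gad _ t) ab = ab
AdjV-sym e (gad _ t) (hub h) ab = ab
AdjV-sym e (gad i s) (gad j t) (refl , ab) = refl , subst T (∨-comm (slotEdge s t) (slotEdge t s)) ab

slotAdj-irrefl : ∀ s → ¬ T (slotAdj s s)
slotAdj-irrefl X ()
slotAdj-irrefl Y ()
slotAdj-irrefl P ()
slotAdj-irrefl X′ ()
slotAdj-irrefl Y′ ()
slotAdj-irrefl P′ ()
slotAdj-irrefl W ()

AdjV-irrefl : ∀ {N} e (a : V N) → ¬ AdjV e a a
AdjV-irrefl e (hub C) ()
AdjV-irrefl e (hub B) ()
AdjV-irrefl e (hub A) ()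
AdjV-irrefl e (gad i s) (_ , aa) = slotAdj-irrefl s aa

AdjV? : ∀ {N} e (a b : V N) → Dec (AdjV e a b)
AdjV? e (hub h) (hub h′) = T? _
AdjV? e (hub h) (gad _ t) = T? _
AdjV? e (gad _ t) (hub h) = T? _
AdjV? e (gad i s) (gad j t) = (i ≟ᶠ j) ×-dec T? _

hub-edge : ∀ h h′ → T (hubEdge h h′ ∨ hubEdge h′ h) → (h ≡ C × h′ ≡ B) ⊎ (h ≡ B × h′ ≡ C)
hub-edge C B _ = inj₁ (refl , refl)
hub-edge B C _ = inj₂ (refl , refl)
hub-edge C C ()
hub-edge C A ()
hub-edge B B ()
hub-edge B A ()
hub-edge A C ()
hub-edge A B ()
hub-edge A A ()

withoutCB⇒withCB : ∀ {N} (a b : V N) → AdjV false a b → AdjV true a b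
withoutCB⇒withCB (hub h) (hub h′) ab = ⊥-elim (subst T (∧-zeroʳ _) ab)
withoutCB⇒withCB (hub h) (gad _ t) ab = ab
withoutCB⇒withCB (gad _ t) (hub h) ab = ab
withoutCB⇒withCB (gad i s) (gad j t) ab = ab

withCB⇒withoutCB : ∀ {N} (a b : V N) → AdjV true a b →
  ¬ (a ≡ hub C × b ≡ hub B) → ¬ (a ≡ hub B × b ≡ hub C) → AdjV false a b
withCB⇒withoutCB (hub h) (hub h′) ab ¬CB ¬BC with hub-edge h h′ (subst T (∧-identityʳ _) ab)
... | inj₁ (refl , refl) = ⊥-elim (¬CB (refl , refl))
... | inj₂ (refl , refl) = ⊥-elim (¬BC (refl , refl))
withCB⇒withoutCB (hub h) (gad _ t) ab _ _ = ab
withCB⇒withoutCB (gad _ t) (hub h) ab _ _ = ab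
withCB⇒withoutCB (gad i s) (gad j t) ab _ _ = ab

-- Numbering the vertices: Fin (nV N) lists the N gadgets (7 vertices each)
-- followed by the three hubs.
nV : ℕ → ℕ
nV zero = 3
nV (suc N) = 7 + nV N

shift : ∀ {N} → V N → V (suc N)
shift (hub h) = hub h
shift (gad i t) = gad (suc i) t

skip7 : ∀ {m} → Fin m → Fin (7 + m)
skip7 j = suc (suc (suc (suc (suc (suc (suc j))))))

decode : ∀ {N} → Fin (nV N) → V N
decode {zero} zero = hub C
decode {zero} (suc zero) = hub B
decode {zero} (suc (suc zero)) = hub A
decode {suc N} zero = gad zero X
decode {suc N} (suc zero) = gad zero Y
decode {suc N} (suc (suc zero)) = gad zero P
decode {suc N} (suc (suc (suc zero))) = gad zero X′
decode {suc N} (suc (suc (suc (suc zero)))) = gad zero Y′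
decode {suc N} (suc (suc (suc (suc (suc zero))))) = gad zero P′
decode {suc N} (suc (suc (suc (suc (suc (suc zero)))))) = gad zero W
decode {suc N} (suc (suc (suc (suc (suc (suc (suc j))))))) = shift (decode j)

slotIndex : ∀ {m} → Slot → Fin (7 + m)
slotIndex X = zero
slotIndex Y = suc zero
slotIndex P = suc (suc zero)
slotIndex X′ = suc (suc (suc zero))
slotIndex Y′ = suc (suc (suc (suc zero)))
slotIndex P′ = suc (suc (suc (suc (suc zero))))
slotIndex W = suc (suc (suc (suc (suc (suc zero)))))

encode : ∀ {N} → V N → Fin (nV N)
encode {zero} (hub C) = zero
encode {zero} (hub B) = suc zero
encode {zero} (hub A) = suc (suc zero)
encode {suc N} (hub h) = skip7 (encode {N} (hub h))
encode {suc N} (gad zero t) = slotIndex t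
encode {suc N} (gad (suc i) t) = skip7 (encode (gad i t))

decode-encode : ∀ {N} (v : V N) → decode (encode v) ≡ v
decode-encode {zero} (hub C) = refl
decode-encode {zero} (hub B) = refl
decode-encode {zero} (hub A) = refl
decode-encode {suc N} (hub h) = cong shift (decode-encode {N} (hub h))
decode-encode {suc N} (gad zero X) = refl
decode-encode {suc N} (gad zero Y) = refl
decode-encode {suc N} (gad zero P) = refl
decode-encode {suc N} (gad zero X′) = refl
decode-encode {suc N} (gad zero Y′) = refl
decode-encode {suc N} (gad zero P′) = refl
decode-encode {suc N} (gad zero W) = refl
decode-encode {suc N} (gad (suc i) t) = cong shift (decode-encode (gad i t))

encode-shift : ∀ {N} (v : V N) → encode (shift v) ≡ skip7 (encode v)
encode-shift (hub h) = refl
encode-shift (gad i t) = refl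

encode-decode : ∀ {N} (u : Fin (nV N)) → encode (decode {N} u) ≡ u
encode-decode {zero} zero = refl
encode-decode {zero} (suc zero) = refl
encode-decode {zero} (suc (suc zero)) = refl
encode-decode {suc N} zero = refl
encode-decode {suc N} (suc zero) = refl
encode-decode {suc N} (suc (suc zero)) = refl
encode-decode {suc N} (suc (suc (suc zero))) = refl
encode-decode {suc N} (suc (suc (suc (suc zero)))) = refl
encode-decode {suc N} (suc (suc (suc (suc (suc zero))))) = refl
encode-decode {suc N} (suc (suc (suc (suc (suc (suc zero)))))) = refl
encode-decode {suc N} (suc (suc (suc (suc (suc (suc (suc j))))))) =
  trans (encode-shift (decode {N} j)) (cong skip7 (encode-decode {N} j))

encode-injective : ∀ {N} {a b : V N} → encode a ≡ encode b → a ≡ b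
encode-injective {a = a} {b} eq = trans (≡.sym (decode-encode a)) (trans (cong decode eq) (decode-encode b))

decode-injective : ∀ {N} {u v : Fin (nV N)} → decode {N} u ≡ decode v → u ≡ v
decode-injective {N} {u} {v} eq = trans (≡.sym (encode-decode {N} u)) (trans (cong encode eq) (encode-decode {N} v))

Gr : (N : ℕ) → Graph (nV N)
Gr N = record
  { Adj = λ u v → AdjV true (decode {N} u) (decode {N} v)
  ; sym = λ {u} {v} → AdjV-sym true (decode {N} u) (decode {N} v)
  ; irrefl = λ {u} → AdjV-irrefl true (decode {N} u)
  }

module _ {N : ℕ} where

  adj-encode : ∀ (a b : V N) → AdjV true a b → Adj (Gr N) (encode a) (encode b)
  adj-encode a b = subst₂ (AdjV true) (≡.sym (decode-encode a)) (≡.sym (decode-encode b))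

  adj-to : ∀ u (b : V N) → Adj (Gr N) u (encode b) → AdjV true (decode u) b
  adj-to u b = subst (AdjV true (decode u)) (decode-encode b)

  adj-from : ∀ u (b : V N) → AdjV true (decode u) b → Adj (Gr N) u (encode b)
  adj-from u b = subst (AdjV true (decode u)) (≡.sym (decode-encode b))

  decoded : ∀ {u} (b : V N) → decode u ≡ b → u ≡ encode b
  decoded {u} b eq = trans (≡.sym (encode-decode {N} u)) (cong encode eq)

near-twins-hit : ∀ {N} (x y p : V N) →
  (∀ v → AdjV true v y → AdjV true v x) →
  (∀ v → AdjV true v x → AdjV true v y ⊎ v ≡ p) →
  (∀ v → AdjV true v p → v ≡ x ⊎ AdjV true v y ⊎ ∃[ w ] (AdjV true v w × AdjV true w y)) →
  x ≢ y → ∀ f → Resolving (Gr N) f →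
  0 < f (encode x) ⊎ 0 < f (encode y) ⊎ 0 < f (encode p)
near-twins-hit {N} x y p N[y]⊆N[x] N[x]⊆N[y]∪p N[p]-near-y x≢y f R =
  NearTwins.broadcast-hits (Gr N) (encode x) (encode y) (encode p)
    (λ u u~y → adj-from u x (N[y]⊆N[x] (decode u) (adj-to u y u~y)))
    N[x]⊆N[y]∪p′ N[p]-near-y′ f R (x≢y ∘ encode-injective)
  where
  N[x]⊆N[y]∪p′ : ∀ u → Adj (Gr N) u (encode x) → Adj (Gr N) u (encode y) ⊎ u ≡ encode p
  N[x]⊆N[y]∪p′ u u~x with N[x]⊆N[y]∪p (decode u) (adj-to u x u~x)
  ... | inj₁ u~y = inj₁ (adj-from u y u~y)
  ... | inj₂ u≡p = inj₂ (decoded p u≡p)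
  N[p]-near-y′ : ∀ u → Adj (Gr N) u (encode p) →
    u ≡ encode x ⊎ Adj (Gr N) u (encode y) ⊎ ∃[ w ] (Adj (Gr N) u w × Adj (Gr N) w (encode y))
  N[p]-near-y′ u u~p with N[p]-near-y (decode u) (adj-to u p u~p)
  ... | inj₁ u≡x = inj₁ (decoded x u≡x)
  ... | inj₂ (inj₁ u~y) = inj₂ (inj₁ (adj-from u y u~y))
  ... | inj₂ (inj₂ (w , u~w , w~y)) = inj₂ (inj₂ (encode w , adj-from u w u~w , adj-encode w y w~y))

Hit : ℕ → ℕ → ℕ → Set
Hit a b c = 0 < a ⊎ 0 < b ⊎ 0 < c

module _ {N : ℕ} (i : Fin N) where

  N[Y]⊆N[X] : ∀ v → AdjV true v (gad i Y) → AdjV true v (gad i X)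
  N[Y]⊆N[X] (hub C) ()
  N[Y]⊆N[X] (hub B) vY = vY
  N[Y]⊆N[X] (hub A) ()
  N[Y]⊆N[X] (gad j W) (refl , _) = refl , tt
  N[Y]⊆N[X] (gad j X) (refl , ())
  N[Y]⊆N[X] (gad j Y) (refl , ())
  N[Y]⊆N[X] (gad j P) (refl , ())
  N[Y]⊆N[X] (gad j X′) (refl , ())
  N[Y]⊆N[X] (gad j Y′) (refl , ())
  N[Y]⊆N[X] (gad j P′) (refl , ())

  N[X]⊆N[Y]∪P : ∀ v → AdjV true v (gad i X) → AdjV true v (gad i Y) ⊎ v ≡ gad i P
  N[X]⊆N[Y]∪P (hub C) ()
  N[X]⊆N[Y]∪P (hub B) _ = inj₁ tt
  N[X]⊆N[Y]∪P (hub A) ()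
  N[X]⊆N[Y]∪P (gad j W) (refl , _) = inj₁ (refl , tt)
  N[X]⊆N[Y]∪P (gad j P) (refl , _) = inj₂ refl
  N[X]⊆N[Y]∪P (gad j X) (refl , ())
  N[X]⊆N[Y]∪P (gad j Y) (refl , ())
  N[X]⊆N[Y]∪P (gad j X′) (refl , ())
  N[X]⊆N[Y]∪P (gad j Y′) (refl , ())
  N[X]⊆N[Y]∪P (gad j P′) (refl , ())

  -- C reaches Y through the edge CB: this is where e is needed.
  N[P]-near-Y : ∀ v → AdjV true v (gad i P) →
    v ≡ gad i X ⊎ AdjV true v (gad i Y) ⊎ ∃[ w ] (AdjV true v w × AdjV true w (gad i Y))
  N[P]-near-Y (hub C) _ = inj₂ (inj₂ (hub B , tt , tt))
  N[P]-near-Y (hub B) ()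
  N[P]-near-Y (hub A) ()
  N[P]-near-Y (gad j X) (refl , _) = inj₁ refl
  N[P]-near-Y (gad j W) (refl , _) = inj₂ (inj₁ (refl , tt))
  N[P]-near-Y (gad j Y) (refl , ())
  N[P]-near-Y (gad j P) (refl , ())
  N[P]-near-Y (gad j X′) (refl , ())
  N[P]-near-Y (gad j Y′) (refl , ())
  N[P]-near-Y (gad j P′) (refl , ())

  N[Y′]⊆N[X′] : ∀ v → AdjV true v (gad i Y′) → AdjV true v (gad i X′)
  N[Y′]⊆N[X′] (hub C) ()
  N[Y′]⊆N[X′] (hub B) vY = vY
  N[Y′]⊆N[X′] (hub A) vY = vY
  N[Y′]⊆N[X′] (gad j W) (refl , _) = refl , tt
  N[Y′]⊆N[X′] (gad j X) (refl , ())
  N[Y′]⊆N[X′] (gad j Y) (refl , ())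
  N[Y′]⊆N[X′] (gad j P) (refl , ())
  N[Y′]⊆N[X′] (gad j X′) (refl , ())
  N[Y′]⊆N[X′] (gad j Y′) (refl , ())
  N[Y′]⊆N[X′] (gad j P′) (refl , ())

  N[X′]⊆N[Y′]∪P′ : ∀ v → AdjV true v (gad i X′) → AdjV true v (gad i Y′) ⊎ v ≡ gad i P′
  N[X′]⊆N[Y′]∪P′ (hub C) ()
  N[X′]⊆N[Y′]∪P′ (hub B) _ = inj₁ tt
  N[X′]⊆N[Y′]∪P′ (hub A) _ = inj₁ tt
  N[X′]⊆N[Y′]∪P′ (gad j W) (refl , _) = inj₁ (refl , tt)
  N[X′]⊆N[Y′]∪P′ (gad j P′) (refl , _) = inj₂ refl
  N[X′]⊆N[Y′]∪P′ (gad j X) (refl , ())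
  N[X′]⊆N[Y′]∪P′ (gad j Y) (refl , ())
  N[X′]⊆N[Y′]∪P′ (gad j P) (refl , ())
  N[X′]⊆N[Y′]∪P′ (gad j X′) (refl , ())
  N[X′]⊆N[Y′]∪P′ (gad j Y′) (refl , ())

  N[P′]-near-Y′ : ∀ v → AdjV true v (gad i P′) →
    v ≡ gad i X′ ⊎ AdjV true v (gad i Y′) ⊎ ∃[ w ] (AdjV true v w × AdjV true w (gad i Y′))
  N[P′]-near-Y′ (hub C) _ = inj₂ (inj₂ (hub B , tt , tt))
  N[P′]-near-Y′ (hub B) ()
  N[P′]-near-Y′ (hub A) _ = inj₂ (inj₁ tt)
  N[P′]-near-Y′ (gad j X′) (refl , _) = inj₁ refl
  N[P′]-near-Y′ (gad j W) (refl , _) = inj₂ (inj₁ (refl , tt))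
  N[P′]-near-Y′ (gad j X) (refl , ())
  N[P′]-near-Y′ (gad j Y) (refl , ())
  N[P′]-near-Y′ (gad j P) (refl , ())
  N[P′]-near-Y′ (gad j Y′) (refl , ())
  N[P′]-near-Y′ (gad j P′) (refl , ())

  gadget-hit : ∀ f → Resolving (Gr N) f →
    Hit (f (encode (gad i X))) (f (encode (gad i Y))) (f (encode (gad i P))) ×
    Hit (f (encode (gad i X′))) (f (encode (gad i Y′))) (f (encode (gad i P′)))
  gadget-hit f R =
    near-twins-hit (gad i X) (gad i Y) (gad i P) N[Y]⊆N[X] N[X]⊆N[Y]∪P N[P]-near-Y (λ ()) f R ,
    near-twins-hit (gad i X′) (gad i Y′) (gad i P′) N[Y′]⊆N[X′] N[X′]⊆N[Y′]∪P′ N[P′]-near-Y′ (λ ()) f R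

hit-sum : ∀ {a b c} r → Hit a b c → suc r ≤ a + (b + (c + r))
hit-sum {a} {b} {c} r (inj₁ 0<a) =
  ℕ.≤-trans (s≤s (ℕ.≤-trans (ℕ.m≤n+m r c) (ℕ.m≤n+m _ b))) (ℕ.+-monoˡ-≤ (b + (c + r)) 0<a)
hit-sum {a} {b} {c} r (inj₂ (inj₁ 0<b)) =
  ℕ.≤-trans (ℕ.≤-trans (s≤s (ℕ.m≤n+m r c)) (ℕ.+-monoˡ-≤ (c + r) 0<b)) (ℕ.m≤n+m _ a)
hit-sum {a} {b} {c} r (inj₂ (inj₂ 0<c)) =
  ℕ.≤-trans (ℕ.≤-trans (ℕ.+-monoˡ-≤ r 0<c) (ℕ.m≤n+m _ b)) (ℕ.m≤n+m _ a)

cost-skip7 : ∀ {m} (f : Fin (7 + m) → ℕ) → cost f ≡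
  f (slotIndex X) + (f (slotIndex Y) + (f (slotIndex P) +
  (f (slotIndex X′) + (f (slotIndex Y′) + (f (slotIndex P′) + (f (slotIndex W) + cost (f ∘ skip7)))))))
cost-skip7 f =
  trans (cost-suc f) (cong (f zero +_)
  (trans (cost-suc (λ j → f (suc j))) (cong (f (suc zero) +_)
  (trans (cost-suc (λ j → f (suc (suc j)))) (cong (f (suc (suc zero)) +_)
  (trans (cost-suc (λ j → f (suc (suc (suc j))))) (cong (f (suc (suc (suc zero))) +_)
  (trans (cost-suc (λ j → f (suc (suc (suc (suc j)))))) (cong (f (suc (suc (suc (suc zero)))) +_)
  (trans (cost-suc (λ j → f (suc (suc (suc (suc (suc j))))))) (cong (f (suc (suc (suc (suc (suc zero))))) +_)
  (cost-suc (λ j → f (suc (suc (suc (suc (suc (suc j)))))))))))))))))))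

gadgets-cost : ∀ N (f : Fin (nV N) → ℕ) →
  (∀ (i : Fin N) → Hit (f (encode (gad i X))) (f (encode (gad i Y))) (f (encode (gad i P))) ×
         Hit (f (encode (gad i X′))) (f (encode (gad i Y′))) (f (encode (gad i P′)))) →
  N + N ≤ cost f
gadgets-cost zero f hits = z≤n
gadgets-cost (suc N) f hits with hits zero | gadgets-cost N (f ∘ skip7) (hits ∘ suc)
... | hit₁ , hit₂ | rest rewrite cost-skip7 f | ℕ.+-suc N N =
  ℕ.≤-trans (s≤s (ℕ.≤-trans (s≤s (ℕ.≤-trans rest (ℕ.m≤n+m _ _))) (hit-sum _ hit₂))) (hit-sum _ hit₁)

bdim-lower : ∀ N f → Resolving (Gr N) f → N + N ≤ cost f
bdim-lower N f R = gadgets-cost N f (λ i → gadget-hit {N} i f R)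

slotBroadcast : Slot → ℕ
slotBroadcast W = 1
slotBroadcast _ = 0

broadcast : ∀ {N} → V N → ℕ
broadcast (hub C) = 2
broadcast (hub B) = 0
broadcast (hub A) = 1
broadcast (gad _ t) = slotBroadcast t

broadcast-shift : ∀ {N} (v : V N) → broadcast (shift v) ≡ broadcast v
broadcast-shift (hub C) = refl
broadcast-shift (hub B) = refl
broadcast-shift (hub A) = refl
broadcast-shift (gad _ t) = refl

broadcast-cost : ∀ N → cost (broadcast ∘ decode {N}) ≡ 3 + N
broadcast-cost zero = refl
broadcast-cost (suc N) = trans (cost-skip7 (broadcast ∘ decode {suc N}))
  (cong suc (trans (cost-cong (λ j → broadcast-shift (decode {N} j))) (broadcast-cost N)))

-- The truncated distances in G_N − CB to C (radius 2), to A and to W_i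
-- (radius 1), as functions of the vertex.
slotToC slotToA slotToW : Slot → ℕ
slotToC X = 2
slotToC Y = 3
slotToC P = 1
slotToC X′ = 2
slotToC Y′ = 3
slotToC P′ = 1
slotToC W = 2
slotToA X′ = 1
slotToA Y′ = 1
slotToA P′ = 1
slotToA _ = 2
slotToW W = 0
slotToW _ = 1

toC : ∀ {N} → V N → ℕ
toC (hub C) = 0
toC (hub B) = 3
toC (hub A) = 2
toC (gad _ t) = slotToC t

toA : ∀ {N} → V N → ℕ
toA (hub C) = 2
toA (hub B) = 2
toA (hub A) = 0
toA (gad _ t) = slotToA t

toW : ∀ {N} → Fin N → V N → ℕ
toW i (hub _) = 2
toW i (gad j t) with i ≟ᶠ j
... | yes _ = slotToW t
... | no _ = 2

toW-same : ∀ {N} (i : Fin N) t → toW i (gad i t) ≡ slotToW t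
toW-same i t with i ≟ᶠ i
... | yes _ = refl
... | no i≢i = ⊥-elim (i≢i refl)

toW-other : ∀ {N} (i j : Fin N) t → i ≢ j → toW i (gad j t) ≡ 2
toW-other i j t i≢j with i ≟ᶠ j
... | yes i≡j = ⊥-elim (i≢j i≡j)
... | no _ = refl

slotToW≢2 : ∀ t → slotToW t ≢ 2
slotToW≢2 W ()
slotToW≢2 X ()
slotToW≢2 Y ()
slotToW≢2 P ()
slotToW≢2 X′ ()
slotToW≢2 Y′ ()
slotToW≢2 P′ ()

slotFromCodes : ℕ → ℕ → ℕ → Slot
slotFromCodes 2 2 1 = X
slotFromCodes 3 2 1 = Y
slotFromCodes 1 2 1 = P
slotFromCodes 2 1 1 = X′
slotFromCodes 3 1 1 = Y′
slotFromCodes 1 1 1 = P′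
slotFromCodes _ _ _ = W

slotFromCodes-correct : ∀ t → slotFromCodes (slotToC t) (slotToA t) (slotToW t) ≡ t
slotFromCodes-correct X = refl
slotFromCodes-correct Y = refl
slotFromCodes-correct P = refl
slotFromCodes-correct X′ = refl
slotFromCodes-correct Y′ = refl
slotFromCodes-correct P′ = refl
slotFromCodes-correct W = refl

codes-separate : ∀ {N} (a b : V N) → a ≢ b →
  toC a ≢ toC b ⊎ toA a ≢ toA b ⊎ ∃[ i ] (toW i a ≢ toW i b)
codes-separate (hub C) (hub C) a≢b = ⊥-elim (a≢b refl)
codes-separate (hub B) (hub B) a≢b = ⊥-elim (a≢b refl)
codes-separate (hub A) (hub A) a≢b = ⊥-elim (a≢b refl)
codes-separate (hub C) (hub B) _ = inj₁ λ ()
codes-separate (hub C) (hub A) _ = inj₁ λ ()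
codes-separate (hub B) (hub C) _ = inj₁ λ ()
codes-separate (hub B) (hub A) _ = inj₁ λ ()
codes-separate (hub A) (hub C) _ = inj₁ λ ()
codes-separate (hub A) (hub B) _ = inj₁ λ ()
codes-separate (hub _) (gad j t) _ =
  inj₂ (inj₂ (j , λ eq → slotToW≢2 t (trans (≡.sym (toW-same j t)) (≡.sym eq))))
codes-separate (gad i s) (hub _) _ =
  inj₂ (inj₂ (i , λ eq → slotToW≢2 s (trans (≡.sym (toW-same i s)) eq)))
codes-separate (gad i s) (gad j t) a≢b with i ≟ᶠ j
... | no i≢j = inj₂ (inj₂ (i , λ eq →
        slotToW≢2 s (trans (≡.sym (toW-same i s)) (trans eq (toW-other i j t i≢j)))))
... | yes refl with slotToC s ℕ.≟ slotToC t | slotToA s ℕ.≟ slotToA t | slotToW s ℕ.≟ slotToW t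
...   | no c≢ | _ | _ = inj₁ c≢
...   | yes _ | no a≢ | _ = inj₂ (inj₁ a≢)
...   | yes _ | yes _ | no w≢ =
        inj₂ (inj₂ (i , λ eq → w≢ (trans (≡.sym (toW-same i s)) (trans eq (toW-same i t)))))
...   | yes c≡ | yes a≡ | yes w≡ = ⊥-elim (a≢b (cong (gad i) (begin
        s                                                   ≡⟨ ≡.sym (slotFromCodes-correct s) ⟩
        slotFromCodes (slotToC s) (slotToA s) (slotToW s)   ≡⟨ cong₂ (λ c a → slotFromCodes c a (slotToW s)) c≡ a≡ ⟩
        slotFromCodes (slotToC t) (slotToA t) (slotToW s)   ≡⟨ cong (slotFromCodes _ _) w≡ ⟩
        slotFromCodes (slotToC t) (slotToA t) (slotToW t)   ≡⟨ slotFromCodes-correct t ⟩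
        t                                                   ∎)))
  where open ≡.≡-Reasoning

B-far-from-C : ∀ {N} (w : V N) → AdjV false (hub B) w → AdjV false w (hub C) → ⊥
B-far-from-C (hub C) () _
B-far-from-C (hub B) () _
B-far-from-C (hub A) () _
B-far-from-C (gad j X) _ ()
B-far-from-C (gad j Y) _ ()
B-far-from-C (gad j P) () _
B-far-from-C (gad j X′) _ ()
B-far-from-C (gad j Y′) _ ()
B-far-from-C (gad j P′) () _
B-far-from-C (gad j W) () _

Y-far-from-C : ∀ {N} (i : Fin N) (w : V N) → AdjV false (gad i Y) w → AdjV false w (hub C) → ⊥
Y-far-from-C i (hub C) () _
Y-far-from-C i (hub B) _ ()
Y-far-from-C i (hub A) () _
Y-far-from-C i (gad j X) _ ()
Y-far-from-C i (gad j Y) _ ()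
Y-far-from-C i (gad j P) (_ , ()) _
Y-far-from-C i (gad j X′) _ ()
Y-far-from-C i (gad j Y′) _ ()
Y-far-from-C i (gad j P′) (_ , ()) _
Y-far-from-C i (gad j W) _ ()

Y′-far-from-C : ∀ {N} (i : Fin N) (w : V N) → AdjV false (gad i Y′) w → AdjV false w (hub C) → ⊥
Y′-far-from-C i (hub C) () _
Y′-far-from-C i (hub B) _ ()
Y′-far-from-C i (hub A) _ ()
Y′-far-from-C i (gad j X) _ ()
Y′-far-from-C i (gad j Y) _ ()
Y′-far-from-C i (gad j P) (_ , ()) _
Y′-far-from-C i (gad j X′) _ ()
Y′-far-from-C i (gad j Y′) _ ()
Y′-far-from-C i (gad j P′) (_ , ()) _
Y′-far-from-C i (gad j W) _ ()

module UpperBound (K : ℕ) where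

  -- At least one gadget is needed to connect B and A to C in G_N − CB.
  N : ℕ
  N = suc K

  G : Graph (nV N)
  G = Gr N

  vC vB vA : Fin (nV N)
  vC = encode {N} (hub C)
  vB = encode {N} (hub B)
  vA = encode {N} (hub A)

  G−e : Graph (nV N)
  G−e = removeEdge G vC vB

  CB-edge : Adj G vC vB
  CB-edge = adj-encode {N} (hub C) (hub B) tt

  to-V : ∀ {u v} → Adj G−e u v → AdjV false (decode {N} u) (decode {N} v)
  to-V {u} {v} (uv , ¬e) = withCB⇒withoutCB (decode {N} u) (decode {N} v) uv
    (λ { (u≡C , v≡B) → ¬e (inj₁ (decoded (hub C) u≡C , decoded (hub B) v≡B)) })
    (λ { (u≡B , v≡C) → ¬e (inj₂ (decoded (hub B) u≡B , decoded (hub C) v≡C)) })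

  from-V : ∀ {u v} → AdjV false (decode {N} u) (decode {N} v) → Adj G−e u v
  from-V {u} {v} uv = withoutCB⇒withCB (decode {N} u) (decode {N} v) uv , λ
    { (inj₁ (refl , refl)) → subst₂ (AdjV false) (decode-encode {N} (hub C)) (decode-encode {N} (hub B)) uv
    ; (inj₂ (refl , refl)) → subst₂ (AdjV false) (decode-encode {N} (hub B)) (decode-encode {N} (hub C)) uv }

  adj? : DecAdj G
  adj? u v = AdjV? true (decode {N} u) (decode {N} v)

  adj−e? : DecAdj G−e
  adj−e? u v = adj? u v ×-dec ¬? (((u ≟ᶠ vC) ×-dec (v ≟ᶠ vB)) ⊎-dec ((u ≟ᶠ vB) ×-dec (v ≟ᶠ vC)))

  adj−e : ∀ (a b : V N) → AdjV false a b → Adj G−e (encode a) (encode b)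
  adj−e a b ab = from-V (subst₂ (AdjV false) (≡.sym (decode-encode a)) (≡.sym (decode-encode b)) ab)

  nonadj−e : ∀ (a b : V N) → ¬ AdjV false a b → ¬ Adj G−e (encode a) (encode b)
  nonadj−e a b ¬ab ab = ¬ab (subst₂ (AdjV false) (decode-encode a) (decode-encode b) (to-V ab))

  no-path2−e : ∀ (a b : V N) → (∀ w → AdjV false a w → AdjV false w b → ⊥) →
    ∀ w → Adj G−e (encode a) w → Adj G−e w (encode b) → ⊥
  no-path2−e a b ¬path w aw wb =
    ¬path (decode {N} w) (subst (λ q → AdjV false q (decode {N} w)) (decode-encode a) (to-V aw))
                     (subst (AdjV false (decode {N} w)) (decode-encode b) (to-V wb))

  distinct : ∀ {a b : V N} → a ≢ b → encode a ≢ encode b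
  distinct a≢b = a≢b ∘ encode-injective

  _⟶_ : ∀ (a b : V N) {k} → AdjV false a b → Walk G−e (encode b) vC k → Walk G−e (encode a) vC (suc k)
  (a ⟶ b) ab rest = cons (adj−e a b ab) rest

  walk-to-C : ∀ (v : V N) → ∃[ k ] Walk G−e (encode v) vC k
  walk-to-C (hub C) = _ , nil
  walk-to-C (hub B) = _ , (hub B ⟶ gad zero X) tt ((gad zero X ⟶ gad zero P) (refl , tt) ((gad zero P ⟶ hub C) tt nil))
  walk-to-C (hub A) = _ , (hub A ⟶ gad zero P′) tt ((gad zero P′ ⟶ hub C) tt nil)
  walk-to-C (gad i X) = _ , (gad i X ⟶ gad i P) (refl , tt) ((gad i P ⟶ hub C) tt nil)
  walk-to-C (gad i Y) = _ , (gad i Y ⟶ gad i W) (refl , tt) ((gad i W ⟶ gad i P) (refl , tt) ((gad i P ⟶ hub C) tt nil))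
  walk-to-C (gad i P) = _ , (gad i P ⟶ hub C) tt nil
  walk-to-C (gad i X′) = _ , (gad i X′ ⟶ gad i P′) (refl , tt) ((gad i P′ ⟶ hub C) tt nil)
  walk-to-C (gad i Y′) = _ , (gad i Y′ ⟶ gad i W) (refl , tt) ((gad i W ⟶ gad i P′) (refl , tt) ((gad i P′ ⟶ hub C) tt nil))
  walk-to-C (gad i P′) = _ , (gad i P′ ⟶ hub C) tt nil
  walk-to-C (gad i W) = _ , (gad i W ⟶ gad i P) (refl , tt) ((gad i P ⟶ hub C) tt nil)

  G−e-connected : Connected G−e
  G−e-connected u v with subst (λ q → ∃[ k ] Walk G−e q vC k) (encode-decode {N} u) (walk-to-C (decode u))
                       | subst (λ q → ∃[ k ] Walk G−e q vC k) (encode-decode {N} v) (walk-to-C (decode v))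
  ... | _ , u⟶C | _ , v⟶C = _ , (u⟶C ++ʷ reverse v⟶C)

  G-connected : Connected G
  G-connected u v with G−e-connected u v
  ... | k , w = k , mapWalk proj₁ w

  open LocalDistance G−e
  open Distances G−e adj−e? G−e-connected using (tdist-intro)

  at-self : ∀ r (a : V N) → TDist G−e r (encode a) (encode a) 0
  at-self r a = tdist-intro r 0 λ δ → cong (_⊓ suc r) (dist-self δ)

  at-neighbour : ∀ r (a z : V N) → a ≢ z → AdjV false a z → TDist G−e r (encode a) (encode z) 1
  at-neighbour r a z a≢z az = tdist-intro r 1 λ δ → cong (_⊓ suc r) (dist-adj (distinct a≢z) (adj−e a z az) δ)

  beyond-1 : ∀ (a z : V N) → a ≢ z → ¬ AdjV false a z → TDist G−e 1 (encode a) (encode z) 2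
  beyond-1 a z a≢z ¬az = tdist-intro 1 2 λ δ → ℕ.m≥n⇒m⊓n≡n (dist-≥2 (distinct a≢z) (nonadj−e a z ¬az) δ)

  two-from-C : ∀ (a w : V N) → a ≢ hub C → ¬ AdjV false a (hub C) → AdjV false a w → AdjV false w (hub C) →
    TDist G−e 2 (encode a) vC 2
  two-from-C a w a≢C ¬aC aw wC = tdist-intro 2 2 λ δ →
    cong (_⊓ 3) (dist-two (distinct a≢C) (nonadj−e a (hub C) ¬aC) (adj−e a w aw) (adj−e w (hub C) wC) δ)

  beyond-2-from-C : ∀ (a : V N) → a ≢ hub C → ¬ AdjV false a (hub C) →
    (∀ w → AdjV false a w → AdjV false w (hub C) → ⊥) → TDist G−e 2 (encode a) vC 3
  beyond-2-from-C a a≢C ¬aC ¬path = tdist-intro 2 3 λ δ →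
    ℕ.m≥n⇒m⊓n≡n (dist-≥3 (distinct a≢C) (nonadj−e a (hub C) ¬aC) (no-path2−e a (hub C) ¬path) δ)

  tdist-C : ∀ (v : V N) → TDist G−e 2 (encode v) vC (toC v)
  tdist-C (hub C) = at-self 2 (hub C)
  tdist-C (hub B) = beyond-2-from-C (hub B) (λ ()) (λ ()) B-far-from-C
  tdist-C (hub A) = two-from-C (hub A) (gad zero P′) (λ ()) (λ ()) tt tt
  tdist-C (gad i X) = two-from-C (gad i X) (gad i P) (λ ()) (λ ()) (refl , tt) tt
  tdist-C (gad i Y) = beyond-2-from-C (gad i Y) (λ ()) (λ ()) (Y-far-from-C i)
  tdist-C (gad i P) = at-neighbour 2 (gad i P) (hub C) (λ ()) tt
  tdist-C (gad i X′) = two-from-C (gad i X′) (gad i P′) (λ ()) (λ ()) (refl , tt) tt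
  tdist-C (gad i Y′) = beyond-2-from-C (gad i Y′) (λ ()) (λ ()) (Y′-far-from-C i)
  tdist-C (gad i P′) = at-neighbour 2 (gad i P′) (hub C) (λ ()) tt
  tdist-C (gad i W) = two-from-C (gad i W) (gad i P) (λ ()) (λ ()) (refl , tt) tt

  tdist-A : ∀ (v : V N) → TDist G−e 1 (encode v) vA (toA v)
  tdist-A (hub C) = beyond-1 (hub C) (hub A) (λ ()) (λ ())
  tdist-A (hub B) = beyond-1 (hub B) (hub A) (λ ()) (λ ())
  tdist-A (hub A) = at-self 1 (hub A)
  tdist-A (gad i X) = beyond-1 (gad i X) (hub A) (λ ()) (λ ())
  tdist-A (gad i Y) = beyond-1 (gad i Y) (hub A) (λ ()) (λ ())
  tdist-A (gad i P) = beyond-1 (gad i P) (hub A) (λ ()) (λ ())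
  tdist-A (gad i X′) = at-neighbour 1 (gad i X′) (hub A) (λ ()) tt
  tdist-A (gad i Y′) = at-neighbour 1 (gad i Y′) (hub A) (λ ()) tt
  tdist-A (gad i P′) = at-neighbour 1 (gad i P′) (hub A) (λ ()) tt
  tdist-A (gad i W) = beyond-1 (gad i W) (hub A) (λ ()) (λ ())

  tdist-W : ∀ i (v : V N) → TDist G−e 1 (encode v) (encode (gad i W)) (toW i v)
  tdist-W i (hub C) = beyond-1 (hub C) (gad i W) (λ ()) (λ ())
  tdist-W i (hub B) = beyond-1 (hub B) (gad i W) (λ ()) (λ ())
  tdist-W i (hub A) = beyond-1 (hub A) (gad i W) (λ ()) (λ ())
  tdist-W i (gad j t) with i ≟ᶠ j
  tdist-W i (gad j t) | no i≢j = beyond-1 (gad j t) (gad i W) (λ { refl → i≢j refl }) (λ { (j≡i , _) → i≢j (≡.sym j≡i) })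
  tdist-W i (gad .i X) | yes refl = at-neighbour 1 (gad i X) (gad i W) (λ ()) (refl , tt)
  tdist-W i (gad .i Y) | yes refl = at-neighbour 1 (gad i Y) (gad i W) (λ ()) (refl , tt)
  tdist-W i (gad .i P) | yes refl = at-neighbour 1 (gad i P) (gad i W) (λ ()) (refl , tt)
  tdist-W i (gad .i X′) | yes refl = at-neighbour 1 (gad i X′) (gad i W) (λ ()) (refl , tt)
  tdist-W i (gad .i Y′) | yes refl = at-neighbour 1 (gad i Y′) (gad i W) (λ ()) (refl , tt)
  tdist-W i (gad .i P′) | yes refl = at-neighbour 1 (gad i P′) (gad i W) (λ ()) (refl , tt)
  tdist-W i (gad .i W) | yes refl = at-self 1 (gad i W)

  tdist-all : ∀ {r} z (code : V N → ℕ) → (∀ v → TDist G−e r (encode v) z (code v)) →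
    ∀ u → TDist G−e r u z (code (decode u))
  tdist-all {r} z code tdist u = subst (λ q → TDist G−e r q z (code (decode u))) (encode-decode {N} u) (tdist (decode u))

  f₀ : Fin (nV N) → ℕ
  f₀ = broadcast ∘ decode {N}

  separated-by : ∀ {x y a b} z r → r ≡ f₀ z → 0 < r →
    TDist G−e r x z a → TDist G−e r y z b → a ≢ b →
    ∃[ z ] (0 < f₀ z × ∃[ a ] ∃[ b ] (TDist G−e (f₀ z) x z a × TDist G−e (f₀ z) y z b × a ≢ b))
  separated-by z r refl 0<r ta tb a≢b = z , 0<r , _ , _ , ta , tb , a≢b

  f₀-resolving : Resolving G−e f₀
  f₀-resolving x y x≢y with codes-separate (decode x) (decode y) (x≢y ∘ decode-injective)
  ... | inj₁ c≢ = separated-by vC 2 (cong broadcast (≡.sym (decode-encode {N} (hub C)))) (s≤s z≤n)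
                    (tdist-all vC toC tdist-C x) (tdist-all vC toC tdist-C y) c≢
  ... | inj₂ (inj₁ a≢) = separated-by vA 1 (cong broadcast (≡.sym (decode-encode {N} (hub A)))) (s≤s z≤n)
                    (tdist-all vA toA tdist-A x) (tdist-all vA toA tdist-A y) a≢
  ... | inj₂ (inj₂ (i , w≢)) = separated-by (encode (gad i W)) 1 (cong broadcast (≡.sym (decode-encode (gad i W)))) (s≤s z≤n)
                    (tdist-all _ (toW i) (tdist-W i) x) (tdist-all _ (toW i) (tdist-W i) y) w≢

balance : ∀ M → (3 + (3 + M)) + M ≡ (3 + M) + (3 + M)
balance M = cong (3 +_) (ℕ.+-comm (3 + M) M)

theorem1p8 : ∀ (M : ℕ) → ∃[ n ] Σ (Graph n) λ G → ∃[ a ] ∃[ b ]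
    (Adj G a b × Connected G × Connected (removeEdge G a b)
      × ∃[ β ] ∃[ β' ] (IsBdim G β × IsBdim (removeEdge G a b) β' × β' + M ≤ β))
theorem1p8 M =
  nV N , G , vC , vB , CB-edge , G-connected , G−e-connected ,
  with-bdims (Distances.bdim-exists G adj? G-connected) (Distances.bdim-exists G−e adj−e? G−e-connected)
  where
  open UpperBound (2 + M)
  open ℕ.≤-Reasoning
  gap : ∀ {β β′} → IsBdim G β → IsBdim G−e β′ → β′ + M ≤ β
  gap {β} {β′} bdim bdim−e = begin
    β′ + M        ≤⟨ ℕ.+-monoˡ-≤ M (subst (β′ ≤_) (broadcast-cost N) (bdim-≤ f₀-resolving bdim−e)) ⟩
    (3 + N) + M   ≡⟨ balance M ⟩
    N + N         ≤⟨ bdim-≥ (bdim-lower N) bdim ⟩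
    β             ∎
  -- β and β′ stay abstract here, so their defining search is never unfolded.
  with-bdims : ∃[ β ] IsBdim G β → ∃[ β′ ] IsBdim G−e β′ →
    ∃[ β ] ∃[ β′ ] (IsBdim G β × IsBdim G−e β′ × β′ + M ≤ β)
  with-bdims (β , bdim) (β′ , bdim−e) = β , β′ , bdim , bdim−e , gap bdim bdim−e
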